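{- There is no $\mathrm{PPL}$-complete problem under DLOGTIME reductions; that is, there is no problem $\mathcal{P}\in\mathrm{PPL}$ such that every problem in $\mathrm{PPL}$ is DLOGTIME-reducible to $\mathcal{P}$.
   Context: A random-access Turing machine (RATM) is a multi-tape Turing machine with read-only input tape and work tapes, each non-index tape having a binary index tape, and a random-access state moving each non-index tape head in one step to the cell addressed by its index tape. For $i\ge1$, $\mathrm{PPL}^i$ is the class of problems decidable by a RATM in $O(\log^i n)$ time, $n$ the input length, and $\mathrm{PPL}=\bigcup_i\mathrm{PPL}^i$ is the class of problems decidable by a RATM in $O(\mathrm{polylog}(n))$ time. A DLOGTIME reduction from $\mathcal{P}_1$ to $\mathcal{P}_2$ is a function $f$ with $|f(x)|$ polynomially bounded in $|x|$ such that $x\in\mathcal{P}_1\iff f(x)\in\mathcal{P}_2$ and such that, given $x$ and $i$, the $i$-th symbol of $f(x)$ (and whether $i\le|f(x)|$) can be computed by a RATM in $O(\log|x|)$ time. -}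

module Defs where

open import Level using (0ℓ)
open import Data.Nat using (ℕ; zero; suc; _+_; _*_; _^_; _≤_; _/_; _%_; _≟_)
open import Data.Nat.Logarithm using (⌈log₂_⌉)
open import Data.Bool using (Bool; true; false; if_then_else_)
open import Data.List using (List; []; _∷_; length; reverse)
open import Data.Maybe using (Maybe; just; nothing)
open import Data.Fin using (Fin; zero; suc)
open import Data.Product using (Σ; _×_; _,_; ∃)
open import Function.Bundles using (_⇔_)
open import Relation.Binary.PropositionalEquality using (_≡_)
open import Relation.Nullary using (¬_; yes; no)

Problem : Set₁
Problem = List Bool → Set

-- Tapes are one-way infinite (cells 0,1,2,...); a tape is stored as a
-- finite list, all cells beyond the list being blank.
--  * input tape: read-only, holds x in cells 0..|x|-1, symbol type
--    Maybe Bool (nothing = blank);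
--  * k work tapes over the alphabet Fin (suc g), with zero = blank;
--  * k+1 binary index tapes (index 0 belongs to the input tape, index
--    suc j to work tape j), symbol type Maybe Bool (nothing = blank).

data Move : Set where
  L S R : Move

data Kind (O : Set) : Set where
  ordinary     : Kind O
  randomAccess : Kind O
  halt         : O → Kind O

record RATM (O : Set) : Set where
  field
    k     : ℕ
    g     : ℕ
    Q     : ℕ
    start : Fin Q
    kind  : Fin Q → Kind O
    δ     : Fin Q → Maybe Bool → (Fin k → Fin (suc g)) → (Fin (suc k) → Maybe Bool) →
            Fin Q × (Fin k → Fin (suc g)) × (Fin (suc k) → Maybe Bool) ×
            Move × (Fin k → Move) × (Fin (suc k) → Move)
    raNext : Fin Q → Fin Q

readCell : {A : Set} → A → List A → ℕ → A
readCell b []      _       = b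
readCell b (a ∷ _) zero    = a
readCell b (_ ∷ l) (suc n) = readCell b l n

writeCell : {A : Set} → A → List A → ℕ → A → List A
writeCell b []      zero    a = a ∷ []
writeCell b []      (suc n) a = b ∷ writeCell b [] n a
writeCell b (_ ∷ l) zero    a = a ∷ l
writeCell b (c ∷ l) (suc n) a = c ∷ writeCell b l n a

moveHead : Move → ℕ → ℕ
moveHead L zero    = zero
moveHead L (suc n) = n
moveHead S n       = n
moveHead R n       = suc n

address : List (Maybe Bool) → ℕ
address = go 0
  where
  go : ℕ → List (Maybe Bool) → ℕ
  go acc []             = acc
  go acc (nothing ∷ _)  = acc
  go acc (just b ∷ l)   = go (2 * acc + (if b then 1 else 0)) l

-- binary representation of a natural number (most significant bit
-- first; 0 is represented by the empty string)
isOne : ℕ → Bool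
isOne 1 = true
isOne _ = false

bitsLSB : ℕ → ℕ → List Bool
bitsLSB zero    _ = []
bitsLSB (suc f) zero = []
bitsLSB (suc f) (suc m) = isOne (suc m % 2) ∷ bitsLSB f (suc m / 2)

binary : ℕ → List (Maybe Bool)
binary n = mapJ (reverse (bitsLSB n n))
  where
  mapJ : List Bool → List (Maybe Bool)
  mapJ []      = []
  mapJ (b ∷ l) = just b ∷ mapJ l

module _ {O : Set} (M : RATM O) where
  open RATM M

  record Config : Set where
    constructor config
    field
      state   : Fin Q
      inPos   : ℕ
      work    : Fin k → List (Fin (suc g))
      workPos : Fin k → ℕ
      idx     : Fin (suc k) → List (Maybe Bool)
      idxPos  : Fin (suc k) → ℕ

  initial : List Bool → ℕ → Config
  initial x i = config start 0 (λ _ → []) (λ _ → 0) ix (λ _ → 0)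
    where
    ix : Fin (suc k) → List (Maybe Bool)
    ix zero    = binary i
    ix (suc _) = []

  inputSymbol : List Bool → ℕ → Maybe Bool
  inputSymbol []      _       = nothing
  inputSymbol (b ∷ _) zero    = just b
  inputSymbol (_ ∷ l) (suc n) = inputSymbol l n

  stepWith : List Bool → Config → Kind O → Config
  stepWith x c (halt _) = c
  stepWith x (config q ip w wp ix ixp) randomAccess =
    config (raNext q) (address (ix zero)) w (λ j → address (ix (suc j))) ix ixp
  stepWith x (config q ip w wp ix ixp) ordinary with
    δ q (inputSymbol x ip) (λ j → readCell zero (w j) (wp j))
        (λ j → readCell nothing (ix j) (ixp j))
  ... | q' , ws , is , mi , mw , mix =
    config q' (moveHead mi ip)
      (λ j → writeCell zero (w j) (wp j) (ws j)) (λ j → moveHead (mw j) (wp j))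
      (λ j → writeCell nothing (ix j) (ixp j) (is j)) (λ j → moveHead (mix j) (ixp j))

  step : List Bool → Config → Config
  step x c = stepWith x c (kind (Config.state c))

  run : List Bool → ℕ → Config → Config
  run x zero    c = c
  run x (suc t) c = run x t (step x c)

  outputOf : Kind O → Maybe O
  outputOf (halt o) = just o
  outputOf _        = nothing

  HaltsWith : List Bool → ℕ → ℕ → O → Set
  HaltsWith x i t o = outputOf (kind (Config.state (run x t (initial x i)))) ≡ just o

DecidesIn : RATM Bool → Problem → (ℕ → ℕ) → Set
DecidesIn M P T =
  ∀ x → Σ ℕ λ t → t ≤ T (length x) ×
        Σ Bool λ b → HaltsWith M x 0 t b × (P x ⇔ (b ≡ true))

PPLⁱ : ℕ → Problem → Set
PPLⁱ i P = Σ (RATM Bool) λ M → Σ ℕ λ c →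
  DecidesIn M P (λ n → c * (1 + ⌈log₂ n ⌉) ^ i)

PPL : Problem → Set
PPL P = Σ ℕ λ i → PPLⁱ (suc i) P

symbolAt : List Bool → ℕ → Maybe Bool
symbolAt []      _       = nothing
symbolAt (b ∷ _) zero    = just b
symbolAt (_ ∷ l) (suc j) = symbolAt l j

-- A RATM computes the bits of f in logarithmic time: started on input x
-- with the (1-based) position i = suc j written in binary on the input's
-- index tape, it halts within c·(1 + log|x| + log i) steps with output
-- just (the i-th symbol of f x) if i ≤ |f x|, and nothing otherwise.
BitsInLogTime : (List Bool → List Bool) → Set
BitsInLogTime f = Σ (RATM (Maybe Bool)) λ M → Σ ℕ λ c →
  ∀ x j → Σ ℕ λ t →
    t ≤ c * (1 + ⌈log₂ length x ⌉ + ⌈log₂ suc j ⌉) ×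
    HaltsWith M x (suc j) t (symbolAt (f x) j)

PolyBounded : (List Bool → List Bool) → Set
PolyBounded f = Σ ℕ λ c → ∀ x → length (f x) ≤ c * length x ^ c + c

DLOGTIMEReduces : Problem → Problem → Set
DLOGTIMEReduces P₁ P₂ = Σ (List Bool → List Bool) λ f →
  PolyBounded f × (∀ x → P₁ x ⇔ P₂ (f x)) × BitsInLogTime f

-- Let P ∈ PPL^(i+1) be complete. A DLOGTIME reduction f of a problem Q to P, followed by
-- P's machine on f x, makes O(log^(i+1) n) steps, each reading one bit of f x, and each such
-- bit is computed after reading O(log n) bits of x: whether x ∈ Q is determined by
-- O(log^(i+2) n) bits of x. But some Q ∈ PPL is sensitive to more bits: BlockOr (i+2) asks
-- whether one of the (ℓ+1)^(i+3) cells ending at position 2^ℓ, ℓ = ⌈log₂ n⌉, holds a 1, and a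
-- machine decides it with its index tapes serving as the digits of an odometer. On the
-- all-zero input of length 2^N some cell of that block is not among the few that matter;
-- setting it to 1 changes the answer but not the decision.

module Submission where

open import Defs
open import Data.Bool using (Bool; true; false; _∨_; if_then_else_)
open import Data.Bool.Properties using (∨-zeroʳ)
open import Data.Empty using (⊥-elim)
open import Data.Fin as Fin using (Fin; zero; suc; toℕ; combine; remQuot)
open import Data.Fin.Properties using (remQuot-combine; toℕ-injective; toℕ<n)
import Data.Fin.Properties as Finₚ
open import Data.List using (List; []; _∷_; [_]; _++_; length; map; replicate)
open import Data.List.Membership.Propositional using (_∈_; _∉_)
open import Data.List.Membership.Propositional.Properties using (∈-++⁺ˡ; ∈-++⁺ʳ; ∈-++⁻; ∈-∃++; ∈-map⁺)
open import Data.List.Properties using (length-++; length-++-sucʳ; length-map; length-replicate)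
open import Data.List.Relation.Unary.Any using (here; there)
open import Data.Maybe using (Maybe; just; nothing)
open import Data.Maybe.Properties using (just-injective)
open import Data.Nat
open import Data.Nat.Logarithm using (⌈log₂_⌉; ⌈log₂⌉-mono-≤; ⌈log₂2^n⌉≡n)
open import Data.Nat.Properties
open import Data.Nat.Tactic.RingSolver using (solve-∀)
open import Data.List.Membership.DecPropositional _≟_ using (_∈?_)
open import Data.Product using (Σ; _×_; _,_; proj₁; proj₂; ∃; ∃₂)
open import Data.Sum using (inj₁; inj₂)
open import Data.Unit using (⊤; tt)
open import Function using (_∘_)
open import Function.Bundles using (mk⇔; Equivalence)
open import Relation.Binary.Definitions using (tri<; tri≈; tri>)
open import Relation.Binary.PropositionalEquality hiding ([_])
open import Relation.Nullary using (¬_; Dec; yes; no; does)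
open import Relation.Nullary.Decidable using (dec-true; dec-false)

-- Runs of random-access Turing machines

module _ {O : Set} (M : RATM O) where
  open RATM M
  open Config

  inputSymbol≡symbolAt : ∀ x p → inputSymbol M x p ≡ symbolAt x p
  inputSymbol≡symbolAt []      p       = refl
  inputSymbol≡symbolAt (b ∷ x) zero    = refl
  inputSymbol≡symbolAt (b ∷ x) (suc p) = inputSymbol≡symbolAt x p

  run-+ : ∀ x s t c → run M x (s + t) c ≡ run M x t (run M x s c)
  run-+ x zero    t c = refl
  run-+ x (suc s) t c = run-+ x s t (step M x c)

  step-cong-input : ∀ {x x'} c → symbolAt x (inPos c) ≡ symbolAt x' (inPos c) →
                    step M x c ≡ step M x' c
  step-cong-input {x} {x'} (config q ip w wp ix ixp) eq with kind q
  ... | halt o       = refl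
  ... | randomAccess = refl
  ... | ordinary
    rewrite inputSymbol≡symbolAt x ip | inputSymbol≡symbolAt x' ip | eq = refl

  run-cong-input : ∀ {x x'} t c →
    (∀ s → s < t → symbolAt x (inPos (run M x s c)) ≡ symbolAt x' (inPos (run M x s c))) →
    run M x t c ≡ run M x' t c
  run-cong-input zero    c agree = refl
  run-cong-input {x} {x'} (suc t) c agree =
    trans (cong (run M x t) first) (run-cong-input t (step M x' c) λ s s<t →
      subst (λ c' → symbolAt x (inPos (run M x s c')) ≡ symbolAt x' (inPos (run M x s c')))
            first (agree (suc s) (s<s s<t)))
    where
    first : step M x c ≡ step M x' c
    first = step-cong-input c (agree 0 z<s)

  halted-step : ∀ x {c o} → outputOf M (kind (state c)) ≡ just o → step M x c ≡ c
  halted-step x {config q ip w wp ix ixp} halted with kind q | halted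
  ... | halt o | _ = refl

  halted-run : ∀ x {c o} t → outputOf M (kind (state c)) ≡ just o → run M x t c ≡ c
  halted-run x zero    halted = refl
  halted-run x (suc t) halted = trans (cong (run M x t) (halted-step x halted)) (halted-run x t halted)

  headAt : List Bool → ℕ → ℕ → ℕ
  headAt x i s = inPos (run M x s (initial M x i))

  visited : List Bool → ℕ → ℕ → List ℕ
  visited x i zero    = []
  visited x i (suc t) = headAt x i t ∷ visited x i t

  length-visited : ∀ x i t → length (visited x i t) ≡ t
  length-visited x i zero    = refl
  length-visited x i (suc t) = cong suc (length-visited x i t)

  ∈-visited : ∀ {x i t s} → s < t → headAt x i s ∈ visited x i t
  ∈-visited {x} {i} {suc t} {s} s<1+t with s ≟ t
  ... | yes refl = here refl
  ... | no s≢t   = there (∈-visited (≤∧≢⇒< (m<1+n⇒m≤n s<1+t) s≢t))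

  private
    HaltsWith-functional-≤ : ∀ {x i t t' o o'} → t ≤ t' →
      HaltsWith M x i t o → HaltsWith M x i t' o' → o ≡ o'
    HaltsWith-functional-≤ {x} {i} {t} {t'} {o' = o'} t≤t' h h' =
      just-injective (trans (sym h) (subst Halted stays h'))
      where
      Halted : Config M → Set
      Halted c = outputOf M (kind (state c)) ≡ just o'
      stays : run M x t' (initial M x i) ≡ run M x t (initial M x i)
      stays = begin
        run M x t' (initial M x i)                    ≡⟨ cong (λ u → run M x u (initial M x i)) (sym (m+[n∸m]≡n t≤t')) ⟩
        run M x (t + (t' ∸ t)) (initial M x i)        ≡⟨ run-+ x t (t' ∸ t) _ ⟩
        run M x (t' ∸ t) (run M x t (initial M x i))  ≡⟨ halted-run x (t' ∸ t) h ⟩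
        run M x t (initial M x i)                     ∎
        where open ≡-Reasoning

  HaltsWith-functional : ∀ x i t t' {o o'} → HaltsWith M x i t o → HaltsWith M x i t' o' → o ≡ o'
  HaltsWith-functional x i t t' h h' with ≤-total t t'
  ... | inj₁ t≤t' = HaltsWith-functional-≤ t≤t' h h'
  ... | inj₂ t'≤t = sym (HaltsWith-functional-≤ t'≤t h' h)

  HaltsWith-cong-input : ∀ x x' i t {o} →
    (∀ s → s < t → symbolAt x (headAt x i s) ≡ symbolAt x' (headAt x i s)) →
    HaltsWith M x i t o → HaltsWith M x' i t o
  HaltsWith-cong-input x x' i t {o} agree =
    subst (λ c → outputOf M (kind (state c)) ≡ just o) (run-cong-input t (initial M x i) agree)

  HaltsWith-output-cong : ∀ x x' i t t' {o o'} → (∀ p → p ∈ visited x i t → symbolAt x p ≡ symbolAt x' p) →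
    HaltsWith M x i t o → HaltsWith M x' i t' o' → o ≡ o'
  HaltsWith-output-cong x x' i t t' agree h h' =
    HaltsWith-functional x' i t t' (HaltsWith-cong-input x x' i t (λ s s<t → agree _ (∈-visited s<t)) h) h'

unionBelow : (ℕ → List ℕ) → ℕ → List ℕ
unionBelow xs zero    = []
unionBelow xs (suc t) = xs t ++ unionBelow xs t

length-unionBelow : ∀ xs t d → (∀ s → s < t → length (xs s) ≤ d) → length (unionBelow xs t) ≤ t * d
length-unionBelow xs zero    d bound = z≤n
length-unionBelow xs (suc t) d bound = begin
  length (xs t ++ unionBelow xs t)           ≡⟨ length-++ (xs t) ⟩
  length (xs t) + length (unionBelow xs t)   ≤⟨ +-mono-≤ (bound t (n<1+n t)) (length-unionBelow xs t d λ s s<t → bound s (m<n⇒m<1+n s<t)) ⟩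
  d + t * d                                  ∎
  where open ≤-Reasoning

∈-unionBelow : ∀ {xs t s y} → s < t → y ∈ xs s → y ∈ unionBelow xs t
∈-unionBelow {xs} {suc t} {s} s<1+t y∈ with s ≟ t
... | yes refl = ∈-++⁺ˡ y∈
... | no s≢t   = ∈-++⁺ʳ (xs t) (∈-unionBelow (≤∧≢⇒< (m<1+n⇒m≤n s<1+t) s≢t) y∈)

∃∉-below : ∀ k (xs : List ℕ) → length xs < k → ∃ λ r → r < k × r ∉ xs
∃∉-below (suc k) xs len< with k ∈? xs
... | no k∉xs = k , n<1+n k , k∉xs
... | yes k∈xs with ys , zs , refl ← ∈-∃++ k∈xs = remove-k (∃∉-below k (ys ++ zs) shorter)
  where
  shorter : length (ys ++ zs) < k
  shorter = s<s⁻¹ (subst (_< suc k) (length-++-sucʳ ys k zs) len<)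
  remove-k : (∃ λ r → r < k × r ∉ ys ++ zs) → ∃ λ r → r < suc k × r ∉ ys ++ [ k ] ++ zs
  remove-k (r , r<k , r∉) = r , m<n⇒m<1+n r<k , r∉ ∘ drop-k
    where
    drop-k : r ∈ ys ++ [ k ] ++ zs → r ∈ ys ++ zs
    drop-k r∈ with ∈-++⁻ ys r∈
    ... | inj₁ r∈ys         = ∈-++⁺ˡ r∈ys
    ... | inj₂ (here r≡k)   = ⊥-elim (<⇒≢ r<k r≡k)
    ... | inj₂ (there r∈zs) = ∈-++⁺ʳ ys r∈zs

module _ {A : Set} (b : A) where

  readCell-[] : ∀ q → readCell b [] q ≡ b
  readCell-[] zero    = refl
  readCell-[] (suc q) = refl

  readCell-writeCell-same : ∀ l p a → readCell b (writeCell b l p a) p ≡ a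
  readCell-writeCell-same []      zero    a = refl
  readCell-writeCell-same []      (suc p) a = readCell-writeCell-same [] p a
  readCell-writeCell-same (c ∷ l) zero    a = refl
  readCell-writeCell-same (c ∷ l) (suc p) a = readCell-writeCell-same l p a

  readCell-writeCell-other : ∀ l {p q} a → p ≢ q → readCell b (writeCell b l p a) q ≡ readCell b l q
  readCell-writeCell-other []      {zero}  {zero}  a p≢q = ⊥-elim (p≢q refl)
  readCell-writeCell-other []      {zero}  {suc q} a p≢q = readCell-[] q
  readCell-writeCell-other []      {suc p} {zero}  a p≢q = refl
  readCell-writeCell-other []      {suc p} {suc q} a p≢q =
    trans (readCell-writeCell-other [] a (p≢q ∘ cong suc)) (readCell-[] q)
  readCell-writeCell-other (c ∷ l) {zero}  {zero}  a p≢q = ⊥-elim (p≢q refl)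
  readCell-writeCell-other (c ∷ l) {zero}  {suc q} a p≢q = refl
  readCell-writeCell-other (c ∷ l) {suc p} {zero}  a p≢q = refl
  readCell-writeCell-other (c ∷ l) {suc p} {suc q} a p≢q = readCell-writeCell-other l a (p≢q ∘ cong suc)

  readCell-writeCell-readCell : ∀ l p q → readCell b (writeCell b l p (readCell b l p)) q ≡ readCell b l q
  readCell-writeCell-readCell l p q with p ≟ q
  ... | yes refl = readCell-writeCell-same l p _
  ... | no p≢q   = readCell-writeCell-other l _ p≢q

  writeCell-replicate : ∀ (a : A) j → writeCell b (replicate j a) j a ≡ replicate (suc j) a
  writeCell-replicate a zero    = refl
  writeCell-replicate a (suc j) = cong (a ∷_) (writeCell-replicate a j)

-- `address` folds its argument with a local accumulator; unification recovers that fold.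
mutual
  addressFrom : ℕ → List (Maybe Bool) → ℕ
  addressFrom = _

  address-just-true : ∀ l → address (just true ∷ l) ≡ addressFrom 1 l
  address-just-true l with 1
  ... | acc = refl

addressFrom-zeros : ∀ acc j → addressFrom acc (replicate j (just false)) ≡ acc * 2 ^ j
addressFrom-zeros acc zero    = sym (*-identityʳ acc)
addressFrom-zeros acc (suc j) = begin
  addressFrom (2 * acc + 0) (replicate j (just false)) ≡⟨ addressFrom-zeros (2 * acc + 0) j ⟩
  (2 * acc + 0) * 2 ^ j                                ≡⟨ cong (_* 2 ^ j) (trans (+-identityʳ (2 * acc)) (*-comm 2 acc)) ⟩
  acc * 2 * 2 ^ j                                      ≡⟨ *-assoc acc 2 (2 ^ j) ⟩
  acc * 2 ^ suc j                                      ∎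
  where open ≡-Reasoning

address-2^ : ∀ j → address (just true ∷ replicate j (just false)) ≡ 2 ^ j
address-2^ j = trans (address-just-true (replicate j (just false))) (trans (addressFrom-zeros 1 j) (*-identityˡ (2 ^ j)))

-- The problem BlockOr and a machine deciding it

isSet : Maybe Bool → Bool
isSet (just true) = true
isSet _           = false

orDown : List Bool → ℕ → ℕ → Bool → Bool
orDown x p zero    b = b
orDown x p (suc m) b = orDown x (pred p) m (b ∨ isSet (symbolAt x p))

IsCeilLog₂ : ℕ → ℕ → Set
IsCeilLog₂ ℓ n = n ≤ 2 ^ ℓ × (∀ j → j < ℓ → 2 ^ j < n)

BlockOr : ℕ → Problem
BlockOr e x = ∃ λ ℓ → IsCeilLog₂ ℓ (length x) × orDown x (2 ^ ℓ) (suc ℓ ^ suc e) false ≡ true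

ruler : ℕ → ℕ → Maybe Bool
ruler J zero    = nothing
ruler J (suc p) = if p <ᵇ J then just true else nothing

<ᵇ-true : ∀ {m n} → m < n → (m <ᵇ n) ≡ true
<ᵇ-true {zero}  {suc n} _         = refl
<ᵇ-true {suc m} {suc n} (s≤s m<n) = <ᵇ-true m<n

<ᵇ-false : ∀ {m n} → n ≤ m → (m <ᵇ n) ≡ false
<ᵇ-false {m}     {zero}  _         = refl
<ᵇ-false {suc m} {suc n} (s≤s n≤m) = <ᵇ-false n≤m

ruler-marked : ∀ {J p} → p < J → ruler J (suc p) ≡ just true
ruler-marked {J} {p} p<J rewrite <ᵇ-true p<J = refl

ruler-end : ∀ J → ruler J (suc J) ≡ nothing
ruler-end J rewrite <ᵇ-false (≤-refl {J}) = refl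

ruler-0 : ∀ p → ruler 0 p ≡ nothing
ruler-0 zero    = refl
ruler-0 (suc p) = refl

ruler-extend : ∀ J p → p ≢ suc J → ruler J p ≡ ruler (suc J) p
ruler-extend J zero    _     = refl
ruler-extend J (suc p) p≢1+J with p <? J
... | yes p<J rewrite <ᵇ-true p<J | <ᵇ-true (m<n⇒m<1+n p<J) = refl
... | no p≮J  rewrite <ᵇ-false (≮⇒≥ p≮J) | <ᵇ-false (≤∧≢⇒< (≮⇒≥ p≮J) (p≢1+J ∘ cong suc ∘ sym)) = refl

adjustAt : ℕ → (ℕ → ℕ) → (ℕ → ℕ) → ℕ → ℕ
adjustAt j f ds j' = if does (j' ≟ j) then f (ds j) else ds j'

adjustAt-same : ∀ j f ds → adjustAt j f ds j ≡ f (ds j)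
adjustAt-same j f ds rewrite dec-true (j ≟ j) refl = refl

adjustAt-other : ∀ j f ds {j'} → j' ≢ j → adjustAt j f ds j' ≡ ds j'
adjustAt-other j f ds {j'} j'≢j rewrite dec-false (j' ≟ j) j'≢j = refl

nextDigit : ∀ {n} → Fin n → Maybe (Fin n)
nextDigit {suc zero}    zero    = nothing
nextDigit {suc (suc n)} zero    = just (suc zero)
nextDigit {suc (suc n)} (suc d) with nextDigit d
... | just d' = just (suc d')
... | nothing = nothing

nextDigit-just : ∀ {n} {d d' : Fin n} → nextDigit d ≡ just d' → toℕ d' ≡ suc (toℕ d)
nextDigit-just {suc (suc n)} {zero} refl = refl
nextDigit-just {suc (suc n)} {suc d} eq with nextDigit d in eq'
nextDigit-just {suc (suc n)} {suc d} refl | just d' = cong suc (nextDigit-just eq')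

nextDigit-nothing : ∀ {n} {d : Fin (suc n)} → nextDigit d ≡ nothing → toℕ d ≡ n
nextDigit-nothing {zero}  {zero}  _ = refl
nextDigit-nothing {suc n} {suc d} eq with nextDigit d in eq'
nextDigit-nothing {suc n} {suc d} refl | nothing = cong suc (nextDigit-nothing eq')

moveOnly : ∀ {n} → Fin n → Move → Fin n → Move
moveOnly d m d' with d' Fin.≟ d
... | yes _ = m
... | no _  = S

moveOnly-digit : ∀ {n} (d d' : Fin n) m f (ds : ℕ → ℕ) → (∀ i → moveHead m i ≡ f i) →
  moveHead (moveOnly (suc d) m (suc d')) (ds (toℕ d')) ≡ adjustAt (toℕ d) f ds (toℕ d')
moveOnly-digit d d' m f ds m≗f with suc d' Fin.≟ suc d
... | yes d'≡d rewrite Finₚ.suc-injective d'≡d = trans (m≗f _) (sym (adjustAt-same (toℕ d) f ds))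
... | no d'≢d  = sym (adjustAt-other (toℕ d) f ds (d'≢d ∘ cong suc ∘ toℕ-injective))

-- Index tape 0 addresses the input, and the index tape of work tape d holds a ruler (cells
-- 1..J marked, 0 and J+1 blank), so its head position is a digit in 0..J+1. Probing 2^J for
-- J = 0, 1, … finds ℓ while growing the rulers to length ℓ; then the machine scans leftwards
-- from 2^ℓ, counting scanned cells down on these digits like an odometer in base ℓ+1.
module BlockOrMachine (e' : ℕ) where

  e : ℕ
  e = suc e'

  data State : Set where
    start jump check : State
    scan done        : Bool → State
    test reset       : Fin e → Bool → State

  private
    Bool→Fin : Bool → Fin 2
    Bool→Fin false = zero
    Bool→Fin true  = suc zero

    Fin→Bool : Fin 2 → Bool
    Fin→Bool zero    = false
    Fin→Bool (suc _) = true

    tag : State → Fin 7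
    tag start       = zero
    tag jump        = suc zero
    tag check       = suc (suc zero)
    tag (scan _)    = suc (suc (suc zero))
    tag (done _)    = suc (suc (suc (suc zero)))
    tag (test _ _)  = suc (suc (suc (suc (suc zero))))
    tag (reset _ _) = suc (suc (suc (suc (suc (suc zero)))))

    digitOf : State → Fin e
    digitOf (test d _)  = d
    digitOf (reset d _) = d
    digitOf _           = zero

    bitOf : State → Bool
    bitOf (scan b)    = b
    bitOf (done b)    = b
    bitOf (test _ b)  = b
    bitOf (reset _ b) = b
    bitOf _           = false

    fromParts : Fin 7 × Fin e × Fin 2 → State
    fromParts (zero , d , b)                                   = start
    fromParts (suc zero , d , b)                               = jump
    fromParts (suc (suc zero) , d , b)                         = check
    fromParts (suc (suc (suc zero)) , d , b)                   = scan (Fin→Bool b)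
    fromParts (suc (suc (suc (suc zero))) , d , b)             = done (Fin→Bool b)
    fromParts (suc (suc (suc (suc (suc zero)))) , d , b)       = test d (Fin→Bool b)
    fromParts (suc (suc (suc (suc (suc (suc zero))))) , d , b) = reset d (Fin→Bool b)

    fromParts-parts : ∀ s → fromParts (tag s , digitOf s , Bool→Fin (bitOf s)) ≡ s
    fromParts-parts start           = refl
    fromParts-parts jump            = refl
    fromParts-parts check           = refl
    fromParts-parts (scan false)    = refl
    fromParts-parts (scan true)     = refl
    fromParts-parts (done false)    = refl
    fromParts-parts (done true)     = refl
    fromParts-parts (test d false)  = refl
    fromParts-parts (test d true)   = refl
    fromParts-parts (reset d false) = refl
    fromParts-parts (reset d true)  = refl

  NQ : ℕ
  NQ = 7 * (e * 2)

  opaque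
    encode : State → Fin NQ
    encode s = combine (tag s) (combine (digitOf s) (Bool→Fin (bitOf s)))

    decode : Fin NQ → State
    decode q = fromCode (remQuot (e * 2) q)
      where
      fromCode : Fin 7 × Fin (e * 2) → State
      fromCode (t , r) = fromParts (t , remQuot 2 r)

    decode-encode : ∀ s → decode (encode s) ≡ s
    decode-encode s = begin
      decode (encode s)                                       ≡⟨ cong (λ (t , r) → fromParts (t , remQuot 2 r)) (remQuot-combine (tag s) _) ⟩
      fromParts (tag s , remQuot 2 (combine (digitOf s) _))   ≡⟨ cong (λ dr → fromParts (tag s , dr)) (remQuot-combine (digitOf s) _) ⟩
      fromParts (tag s , digitOf s , Bool→Fin (bitOf s))      ≡⟨ fromParts-parts s ⟩
      s                                                       ∎
      where open ≡-Reasoning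

  kindOf : State → Kind Bool
  kindOf jump     = randomAccess
  kindOf (done b) = halt b
  kindOf _        = ordinary

  IndexSymbols : Set
  IndexSymbols = Fin (suc e) → Maybe Bool

  Control : Set
  Control = State × IndexSymbols × Move × (Fin (suc e) → Move)

  stay : Fin (suc e) → Move
  stay _ = S

  markProbe : IndexSymbols
  markProbe zero    = just false
  markProbe (suc _) = just true

  writeStart : IndexSymbols → IndexSymbols
  writeStart r zero    = just true
  writeStart r (suc d) = r (suc d)

  afterCheck : Maybe Bool → IndexSymbols → Control
  afterCheck (just _) r = jump , markProbe , S , (λ _ → R)
  afterCheck nothing  r = scan false , r , S , stay

  afterTest : Fin e → Bool → Maybe Bool → Maybe (Fin e) → IndexSymbols → Control
  afterTest d b (just _) _        r = scan b , r , S , stay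
  afterTest d b nothing  nothing  r = done b , r , S , stay
  afterTest d b nothing  (just _) r = reset d b , r , S , moveOnly (suc d) R

  afterReset : Fin e → Bool → Maybe Bool → Maybe (Fin e) → IndexSymbols → Control
  afterReset d b (just _) _         r = reset d b , r , S , moveOnly (suc d) R
  afterReset d b nothing  nothing   r = done b , r , S , stay
  afterReset d b nothing  (just d') r = test d' b , r , S , moveOnly (suc d') L

  control : State → Maybe Bool → IndexSymbols → Control
  control start       a r = jump , writeStart r , S , (λ _ → R)
  control check       a r = afterCheck a r
  control (scan b)    a r = test zero (b ∨ isSet a) , r , L , moveOnly (suc zero) L
  control (test d b)  a r = afterTest d b (r (suc d)) (nextDigit d) r
  control (reset d b) a r = afterReset d b (r (suc d)) (nextDigit d) r
  -- jump and done are not ordinary states, so this transition is never taken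
  control _           a r = start , r , S , stay

  Transition : Set
  Transition = Fin NQ × (Fin e → Fin 1) × IndexSymbols × Move × (Fin e → Move) × (Fin (suc e) → Move)

  transition : (Fin e → Fin 1) → Control → Transition
  transition w (s , r , mi , mr) = encode s , w , r , mi , (λ _ → S) , mr

  M : RATM Bool
  M = record
    { k = e ; g = 0 ; Q = NQ ; start = encode start
    ; kind = kindOf ∘ decode
    ; δ = λ q a w r → transition w (control (decode q) a r)
    ; raNext = λ _ → encode check }

  open Config

  ordinaryStep : List Bool → Config M → Transition → Config M
  ordinaryStep x (config q ip w wp ix ixp) (q' , ws , is , mi , mw , mix) =
    config q' (moveHead mi ip)
      (λ j → writeCell zero (w j) (wp j) (ws j)) (λ j → moveHead (mw j) (wp j))
      (λ j → writeCell nothing (ix j) (ixp j) (is j)) (λ j → moveHead (mix j) (ixp j))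

  workSymbols : Config M → Fin e → Fin 1
  workSymbols c j = readCell zero (work c j) (workPos c j)

  indexSymbols : Config M → IndexSymbols
  indexSymbols c j = readCell nothing (idx c j) (idxPos c j)

  kind-encode : ∀ s → RATM.kind M (encode s) ≡ kindOf s
  kind-encode s = cong kindOf (decode-encode s)

  step-ordinary : ∀ x c s → state c ≡ encode s → kindOf s ≡ ordinary →
    step M x c ≡ ordinaryStep x c (transition (workSymbols c) (control s (symbolAt x (inPos c)) (indexSymbols c)))
  step-ordinary x c@(config _ ip _ _ _ _) s refl ordinary-s = begin
    stepWith M x c (RATM.kind M (encode s))   ≡⟨ cong (stepWith M x c) (trans (kind-encode s) ordinary-s) ⟩
    stepWith M x c ordinary                   ≡⟨ cong (λ s' → ordinaryStep x c (transition (workSymbols c) (control s' (inputSymbol M x ip) (indexSymbols c)))) (decode-encode s) ⟩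
    ordinaryStep x c (transition (workSymbols c) (control s (inputSymbol M x ip) (indexSymbols c)))
                                              ≡⟨ cong (λ a → ordinaryStep x c (transition (workSymbols c) (control s a (indexSymbols c)))) (inputSymbol≡symbolAt M x ip) ⟩
    ordinaryStep x c (transition (workSymbols c) (control s (symbolAt x ip) (indexSymbols c))) ∎
    where open ≡-Reasoning

  step-jump : ∀ x c → state c ≡ encode jump →
    step M x c ≡ config (encode check) (address (idx c zero)) (work c) (λ j → address (idx c (suc j))) (idx c) (idxPos c)
  step-jump x c@(config _ _ _ _ _ _) refl = cong (stepWith M x c) (kind-encode jump)

  step-done : ∀ x c b → state c ≡ encode (done b) → step M x c ≡ c
  step-done x c@(config _ _ _ _ _ _) b refl = cong (stepWith M x c) (kind-encode (done b))

  data Phase : Set where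
    start jump check : Phase
    scan done        : Bool → Phase
    test reset       : ℕ → Bool → Phase

  phaseOf : State → Phase
  phaseOf start       = start
  phaseOf jump        = jump
  phaseOf check       = check
  phaseOf (scan b)    = scan b
  phaseOf (done b)    = done b
  phaseOf (test d b)  = test (toℕ d) b
  phaseOf (reset d b) = reset (toℕ d) b

  record Abs : Set where
    constructor abs
    field
      phase : Phase
      head  : ℕ
      digit : ℕ → ℕ
      rule  : ℕ

  afterCheckᵃ : Maybe Bool → ℕ → (ℕ → ℕ) → ℕ → Abs
  afterCheckᵃ (just _) h ds J = abs jump h (suc ∘ ds) (suc J)
  afterCheckᵃ nothing  h ds J = abs (scan false) h ds J

  afterTestᵃ : ℕ → Bool → Maybe Bool → ℕ → (ℕ → ℕ) → ℕ → Abs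
  afterTestᵃ j b (just _) h ds J = abs (scan b) h ds J
  afterTestᵃ j b nothing  h ds J =
    if j <ᵇ e' then abs (reset j b) h (adjustAt j suc ds) J else abs (done b) h ds J

  afterResetᵃ : ℕ → Bool → Maybe Bool → ℕ → (ℕ → ℕ) → ℕ → Abs
  afterResetᵃ j b (just _) h ds J = abs (reset j b) h (adjustAt j suc ds) J
  afterResetᵃ j b nothing  h ds J =
    if j <ᵇ e' then abs (test (suc j) b) h (adjustAt (suc j) pred ds) J else abs (done b) h ds J

  astep : List Bool → Abs → Abs
  astep x (abs start     h ds J) = abs jump h (suc ∘ ds) 0
  astep x (abs jump      h ds J) = abs check (2 ^ J) ds J
  astep x (abs check     h ds J) = afterCheckᵃ (symbolAt x h) h ds J
  astep x (abs (scan b)  h ds J) = abs (test 0 (b ∨ isSet (symbolAt x h))) (pred h) (adjustAt 0 pred ds) J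
  astep x (abs (test j b)  h ds J) = afterTestᵃ j b (ruler J (ds j)) h ds J
  astep x (abs (reset j b) h ds J) = afterResetᵃ j b (ruler J (ds j)) h ds J
  astep x (abs (done b)  h ds J) = abs (done b) h ds J

  arun : List Bool → ℕ → Abs → Abs
  arun x zero    a = a
  arun x (suc t) a = arun x t (astep x a)

  arun-+ : ∀ x s t a → arun x (s + t) a ≡ arun x t (arun x s a)
  arun-+ x zero    t a = refl
  arun-+ x (suc s) t a = arun-+ x s t (astep x a)

  ProbeInvariant : (ℕ → ℕ) → ℕ → Config M → Set
  ProbeInvariant ds J c =
    idx c zero ≡ just true ∷ replicate J (just false) × idxPos c zero ≡ suc J × (∀ j → ds j ≡ suc J)

  IndexInvariant : Phase → (ℕ → ℕ) → ℕ → Config M → Set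
  IndexInvariant start ds J c = idx c zero ≡ [] × idxPos c zero ≡ 0 × (∀ j → ds j ≡ 0) × J ≡ 0
  IndexInvariant jump  ds J c = ProbeInvariant ds J c
  IndexInvariant check ds J c = ProbeInvariant ds J c
  IndexInvariant _     _  _ _ = ⊤

  record Represents (a : Abs) (c : Config M) : Set where
    constructor represents
    open Abs a
    field
      state≡ : Σ State λ s → state c ≡ encode s × phaseOf s ≡ phase
      head≡  : inPos c ≡ head
      digit≡ : ∀ d → idxPos c (suc d) ≡ digit (toℕ d)
      rulers : ∀ d p → readCell nothing (idx c (suc d)) p ≡ ruler rule p
      index  : IndexInvariant phase digit rule c

  private
    rulers-kept : ∀ (ix : Fin (suc e) → List (Maybe Bool)) (ixp : Fin (suc e) → ℕ) {J} →
      (∀ d p → readCell nothing (ix (suc d)) p ≡ ruler J p) →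
      ∀ d p → readCell nothing (writeCell nothing (ix (suc d)) (ixp (suc d)) (readCell nothing (ix (suc d)) (ixp (suc d)))) p ≡ ruler J p
    rulers-kept ix ixp rulers d p = trans (readCell-writeCell-readCell nothing (ix (suc d)) (ixp (suc d)) p) (rulers d p)

    moveHead-L : ∀ n → moveHead L n ≡ pred n
    moveHead-L zero    = refl
    moveHead-L (suc n) = refl

    digits-moved : ∀ (ixp : Fin (suc e) → ℕ) ds d m f → (∀ i → moveHead m i ≡ f i) →
      (∀ d' → ixp (suc d') ≡ ds (toℕ d')) →
      ∀ d' → moveHead (moveOnly (suc d) m (suc d')) (ixp (suc d')) ≡ adjustAt (toℕ d) f ds (toℕ d')
    digits-moved ixp ds d m f m≗f digit≡ d' =
      trans (cong (moveHead (moveOnly (suc d) m (suc d'))) (digit≡ d')) (moveOnly-digit d d' m f ds m≗f)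

    last-digit : ∀ {d : Fin e} → nextDigit d ≡ nothing → (toℕ d <ᵇ e') ≡ false
    last-digit next≡ = <ᵇ-false (≤-reflexive (sym (nextDigit-nothing next≡)))

    inner-digit : ∀ {d d' : Fin e} → nextDigit d ≡ just d' → (toℕ d <ᵇ e') ≡ true
    inner-digit {d' = d'} next≡ = <ᵇ-true (s≤s⁻¹ (subst (_< e) (nextDigit-just next≡) (toℕ<n d')))

  Simulates : List Bool → Abs → Config M → Set
  Simulates x a c = Represents a c → Represents (astep x a) (step M x c)

  simulate-start : ∀ x {ip ds J w wp ix ixp} → Simulates x (abs start ip ds J) (config (encode start) ip w wp ix ixp)
  simulate-start x {ip} {ds} {J} {w} {wp} {ix} {ixp} (represents _ _ digit≡ rulers (ix0 , ixp0 , ds0 , J0))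
    rewrite step-ordinary x (config (encode start) ip w wp ix ixp) start refl refl =
    represents (jump , refl , refl) refl (cong suc ∘ digit≡)
      (λ d p → trans (rulers-kept ix ixp rulers d p) (cong (λ J → ruler J p) J0))
      (cong₂ (λ l p → writeCell nothing l p (just true)) ix0 ixp0 , cong suc ixp0 , cong suc ∘ ds0)

  simulate-jump : ∀ x {ip ds J w wp ix ixp} → Simulates x (abs jump ip ds J) (config (encode jump) ip w wp ix ixp)
  simulate-jump x {ip} {ds} {J} {w} {wp} {ix} {ixp} (represents _ _ digit≡ rulers probe@(ix0 , _ , _))
    rewrite step-jump x (config (encode jump) ip w wp ix ixp) refl =
    represents (check , refl , refl) (trans (cong address ix0) (address-2^ J)) digit≡ rulers probe

  simulate-check : ∀ x {ip ds J w wp ix ixp} → Simulates x (abs check ip ds J) (config (encode check) ip w wp ix ixp)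
  simulate-check x {ip} {ds} {J} {w} {wp} {ix} {ixp} (represents _ _ digit≡ rulers (ix0 , ixp0 , dsJ))
    rewrite step-ordinary x (config (encode check) ip w wp ix ixp) check refl refl with symbolAt x ip
  ... | just _  =
    represents (jump , refl , refl) refl (cong suc ∘ digit≡) extended
      ( trans (cong₂ (λ l p → writeCell nothing l p (just false)) ix0 ixp0)
              (cong (just true ∷_) (writeCell-replicate nothing (just false) J))
      , cong suc ixp0 , cong suc ∘ dsJ)
    where
    at-end : ∀ d → ixp (suc d) ≡ suc J
    at-end d = trans (digit≡ d) (dsJ (toℕ d))
    extended : ∀ d p → readCell nothing (writeCell nothing (ix (suc d)) (ixp (suc d)) (just true)) p ≡ ruler (suc J) p
    extended d p with p ≟ suc J
    ... | yes refl rewrite at-end d =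
      trans (readCell-writeCell-same nothing (ix (suc d)) (suc J) (just true)) (sym (ruler-marked (n<1+n J)))
    ... | no p≢1+J =
      trans (readCell-writeCell-other nothing (ix (suc d)) (just true) (λ eq → p≢1+J (trans (sym eq) (at-end d))))
            (trans (rulers d p) (ruler-extend J p p≢1+J))
  ... | nothing = represents (scan false , refl , refl) refl digit≡ (rulers-kept ix ixp rulers) tt

  simulate-scan : ∀ x b {ip ds J w wp ix ixp} → Simulates x (abs (scan b) ip ds J) (config (encode (scan b)) ip w wp ix ixp)
  simulate-scan x b {ip} {ds} {J} {w} {wp} {ix} {ixp} (represents _ _ digit≡ rulers _)
    rewrite step-ordinary x (config (encode (scan b)) ip w wp ix ixp) (scan b) refl refl =
    represents (test zero (b ∨ isSet (symbolAt x ip)) , refl , refl) (moveHead-L ip)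
      (digits-moved ixp ds zero L pred moveHead-L digit≡) (rulers-kept ix ixp rulers) tt

  simulate-test : ∀ x d b {ip ds J w wp ix ixp} →
    Simulates x (abs (test (toℕ d) b) ip ds J) (config (encode (test d b)) ip w wp ix ixp)
  simulate-test x d b {ip} {ds} {J} {w} {wp} {ix} {ixp} (represents _ _ digit≡ rulers _)
    rewrite step-ordinary x (config (encode (test d b)) ip w wp ix ixp) (test d b) refl refl
          | trans (cong (readCell nothing (ix (suc d))) (digit≡ d)) (rulers d (ds (toℕ d)))
    with ruler J (ds (toℕ d))
  ... | just _  = represents (scan b , refl , refl) refl digit≡ (rulers-kept ix ixp rulers) tt
  ... | nothing with nextDigit d in next≡
  ...   | nothing rewrite last-digit next≡ =
    represents (done b , refl , refl) refl digit≡ (rulers-kept ix ixp rulers) tt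
  ...   | just d' rewrite inner-digit next≡ =
    represents (reset d b , refl , refl) refl (digits-moved ixp ds d R suc (λ _ → refl) digit≡) (rulers-kept ix ixp rulers) tt

  simulate-reset : ∀ x d b {ip ds J w wp ix ixp} →
    Simulates x (abs (reset (toℕ d) b) ip ds J) (config (encode (reset d b)) ip w wp ix ixp)
  simulate-reset x d b {ip} {ds} {J} {w} {wp} {ix} {ixp} (represents _ _ digit≡ rulers _)
    rewrite step-ordinary x (config (encode (reset d b)) ip w wp ix ixp) (reset d b) refl refl
          | trans (cong (readCell nothing (ix (suc d))) (digit≡ d)) (rulers d (ds (toℕ d)))
    with ruler J (ds (toℕ d))
  ... | just _  =
    represents (reset d b , refl , refl) refl (digits-moved ixp ds d R suc (λ _ → refl) digit≡) (rulers-kept ix ixp rulers) tt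
  ... | nothing with nextDigit d in next≡
  ...   | nothing rewrite last-digit next≡ =
    represents (done b , refl , refl) refl digit≡ (rulers-kept ix ixp rulers) tt
  ...   | just d' rewrite inner-digit next≡ =
    represents (test d' b , refl , cong (λ j → test j b) (nextDigit-just next≡)) refl
      (λ d'' → trans (digits-moved ixp ds d' L pred moveHead-L digit≡ d'') (cong (λ j → adjustAt j pred ds (toℕ d'')) (nextDigit-just next≡)))
      (rulers-kept ix ixp rulers) tt

  simulate-done : ∀ x b {ip ds J w wp ix ixp} → Simulates x (abs (done b) ip ds J) (config (encode (done b)) ip w wp ix ixp)
  simulate-done x b {ip} {ds} {J} {w} {wp} {ix} {ixp} (represents _ _ digit≡ rulers _)
    rewrite step-done x (config (encode (done b)) ip w wp ix ixp) b refl = represents (done b , refl , refl) refl digit≡ rulers tt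

  simulate : ∀ x a c → Simulates x a c
  simulate x (abs _ _ _ _) (config _ _ _ _ _ _) rep@(represents (start , refl , refl) refl _ _ _)     = simulate-start x rep
  simulate x (abs _ _ _ _) (config _ _ _ _ _ _) rep@(represents (jump , refl , refl) refl _ _ _)      = simulate-jump x rep
  simulate x (abs _ _ _ _) (config _ _ _ _ _ _) rep@(represents (check , refl , refl) refl _ _ _)     = simulate-check x rep
  simulate x (abs _ _ _ _) (config _ _ _ _ _ _) rep@(represents (scan b , refl , refl) refl _ _ _)    = simulate-scan x b rep
  simulate x (abs _ _ _ _) (config _ _ _ _ _ _) rep@(represents (test d b , refl , refl) refl _ _ _)  = simulate-test x d b rep
  simulate x (abs _ _ _ _) (config _ _ _ _ _ _) rep@(represents (reset d b , refl , refl) refl _ _ _) = simulate-reset x d b rep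
  simulate x (abs _ _ _ _) (config _ _ _ _ _ _) rep@(represents (done b , refl , refl) refl _ _ _)    = simulate-done x b rep

  simulate-run : ∀ x t a c → Represents a c → Represents (arun x t a) (run M x t c)
  simulate-run x zero    a c rep = rep
  simulate-run x (suc t) a c rep = simulate-run x t (astep x a) (step M x c) (simulate x a c rep)

  initialAbs : Abs
  initialAbs = abs start 0 (λ _ → 0) 0

  represents-initial : ∀ x → Represents initialAbs (initial M x 0)
  represents-initial x =
    represents (start , refl , refl) refl (λ _ → refl)
      (λ d p → trans (readCell-[] nothing p) (sym (ruler-0 p))) (refl , refl , (λ _ → refl) , refl)

  private
    phaseOf-done : ∀ {s b} → phaseOf s ≡ done b → s ≡ done b
    phaseOf-done {done b} refl = refl

  represents-done : ∀ {a c b} → Represents a c → Abs.phase a ≡ done b → outputOf M (RATM.kind M (state c)) ≡ just b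
  represents-done {b = b} (represents (s , state≡ , phase≡) _ _ _ _) phase-done
    rewrite state≡ | phaseOf-done (trans phase≡ phase-done) | kind-encode (done b) = refl

-- Running time of the machine

pred-∸ : ∀ p m → pred p ∸ m ≡ p ∸ suc m
pred-∸ p m = trans (cong (_∸ m) (pred[m∸n]≡m∸[1+n] p 0)) (∸-+-assoc p 1 m)

orDown-+ : ∀ x p m₁ m₂ b → orDown x p (m₁ + m₂) b ≡ orDown x (p ∸ m₁) m₂ (orDown x p m₁ b)
orDown-+ x p zero     m₂ b = refl
orDown-+ x p (suc m₁) m₂ b =
  trans (orDown-+ x (pred p) m₁ m₂ b') (cong (λ q → orDown x q m₂ (orDown x (pred p) m₁ b')) (pred-∸ p m₁))
  where b' = b ∨ isSet (symbolAt x p)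

module Timing (e' : ℕ) (x : List Bool) (ℓ : ℕ) where
  open BlockOrMachine e'

  Full : ℕ → (ℕ → ℕ) → Set
  Full j ds = ∀ j' → j' < j → ds j' ≡ suc ℓ

  record Drained (j : ℕ) (ds ds' : ℕ → ℕ) : Set where
    field
      emptied    : ds' j ≡ 0
      full-below : Full j ds'
      kept-above : ∀ j' → j < j' → ds' j' ≡ ds j'

  Drains : ℕ → ℕ → ℕ → Bool → ℕ → (ℕ → ℕ) → (ℕ → ℕ) → Set
  Drains j m p b t ds ds' =
    arun x t (abs (scan b) p ds ℓ) ≡ abs (test j (orDown x p m b)) (p ∸ m) ds' ℓ × Drained j ds ds'

  drain-first : ∀ v b p ds → ds 0 ≡ suc v → v ≤ ℓ →
    ∃₂ λ t ds' → t ≤ 2 * suc v × Drains 0 (suc v) p b t ds ds'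
  drain-first zero b p ds ds0≡1 _ =
    1 , adjustAt 0 pred ds , s≤s z≤n ,
    cong (λ h → abs (test 0 (b ∨ isSet (symbolAt x p))) h (adjustAt 0 pred ds) ℓ) (pred-∸ p 0) ,
    record { emptied    = trans (adjustAt-same 0 pred ds) (cong pred ds0≡1)
           ; full-below = λ _ ()
           ; kept-above = λ j' 0<j' → adjustAt-other 0 pred ds (>⇒≢ 0<j') }
  drain-first (suc v) b p ds ds0≡ v<ℓ
    with t , ds' , t≤ , run≡ , drained ← drain-first v (b ∨ isSet (symbolAt x p)) (pred p) (adjustAt 0 pred ds)
                                            (trans (adjustAt-same 0 pred ds) (cong pred ds0≡)) (<⇒≤ v<ℓ) =
    2 + t , ds' , ≤-trans (+-monoʳ-≤ 2 t≤) (≤-reflexive (sym (*-suc 2 (suc v)))) ,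
    trans (cong (arun x t) two-steps) (trans run≡ (cong (λ h → abs (test 0 (orDown x p (2 + v) b)) h ds' ℓ) (pred-∸ p (suc v)))) ,
    record { emptied    = Drained.emptied drained
           ; full-below = λ _ ()
           ; kept-above = λ j' 0<j' → trans (Drained.kept-above drained j' 0<j') (adjustAt-other 0 pred ds (>⇒≢ 0<j')) }
    where
    two-steps : astep x (astep x (abs (scan b) p ds ℓ)) ≡ abs (scan (b ∨ isSet (symbolAt x p))) (pred p) (adjustAt 0 pred ds) ℓ
    two-steps rewrite adjustAt-same 0 pred ds | ds0≡ | ruler-marked v<ℓ = refl

  record Refilled (j : ℕ) (ds ds' : ℕ → ℕ) : Set where
    field
      refilled : ds' j ≡ suc ℓ
      borrowed : ds' (suc j) ≡ pred (ds (suc j))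
      kept     : ∀ j' → j' ≢ j → j' ≢ suc j → ds' j' ≡ ds j'

  refill : ∀ f j b p ds u → j < e' → ds j ≡ suc u → u + f ≡ ℓ →
    ∃₂ λ t ds' → t ≤ suc f × arun x t (abs (reset j b) p ds ℓ) ≡ abs (test (suc j) b) p ds' ℓ × Refilled j ds ds'
  refill zero j b p ds u j<e' dsj≡ u+0≡ℓ =
    1 , adjustAt (suc j) pred ds , ≤-refl , one-step ,
    record { refilled = trans (adjustAt-other (suc j) pred ds (<⇒≢ (n<1+n j))) (trans dsj≡ (cong suc u≡ℓ))
           ; borrowed = adjustAt-same (suc j) pred ds
           ; kept     = λ j' _ j'≢1+j → adjustAt-other (suc j) pred ds j'≢1+j }
    where
    u≡ℓ : u ≡ ℓ
    u≡ℓ = trans (sym (+-identityʳ u)) u+0≡ℓ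
    one-step : astep x (abs (reset j b) p ds ℓ) ≡ abs (test (suc j) b) p (adjustAt (suc j) pred ds) ℓ
    one-step rewrite trans (cong (ruler ℓ) (trans dsj≡ (cong suc u≡ℓ))) (ruler-end ℓ) | <ᵇ-true j<e' = refl
  refill (suc f) j b p ds u j<e' dsj≡ u+f≡ℓ
    with t , ds' , t≤ , run≡ , refilled ← refill f j b p (adjustAt j suc ds) (suc u) j<e'
                                               (trans (adjustAt-same j suc ds) (cong suc dsj≡)) (trans (sym (+-suc u f)) u+f≡ℓ) =
    suc t , ds' , s≤s t≤ , trans (cong (arun x t) one-step) run≡ ,
    record { refilled = Refilled.refilled refilled
           ; borrowed = trans (Refilled.borrowed refilled) (cong pred (adjustAt-other j suc ds (<⇒≢ (n<1+n j) ∘ sym)))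
           ; kept     = λ j' j'≢j j'≢1+j → trans (Refilled.kept refilled j' j'≢j j'≢1+j) (adjustAt-other j suc ds j'≢j) }
    where
    one-step : astep x (abs (reset j b) p ds ℓ) ≡ abs (reset j b) p (adjustAt j suc ds) ℓ
    one-step rewrite trans (cong (ruler ℓ) dsj≡) (ruler-marked (≤-trans (s≤s (m≤m+n u f)) (≤-reflexive (trans (sym (+-suc u f)) u+f≡ℓ)))) = refl

  W : ℕ
  W = 3 + ℓ

  -- A head at cell v of ruler j, with the rulers below j full, accounts for v·(ℓ+1)^j more scanned cells.
  DrainsWithin : ℕ → Set
  DrainsWithin j = ∀ v b p ds → ds j ≡ suc v → v ≤ ℓ → Full j ds →
    ∃₂ λ t ds' → t ≤ suc v * W ^ suc j × Drains j (suc v * suc ℓ ^ j) p b t ds ds'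

  drain-zero : DrainsWithin 0
  drain-zero v b p ds ds0≡ v≤ℓ _
    with t , ds' , t≤ , run≡ , drained ← drain-first v b p ds ds0≡ v≤ℓ =
    t , ds' , ≤-trans t≤ (≤-trans (≤-reflexive (*-comm 2 (suc v))) (*-monoʳ-≤ (suc v) (s≤s (s≤s z≤n)))) ,
    subst (λ m → Drains 0 m p b t ds ds') (sym (*-identityʳ (suc v))) (run≡ , drained)

  record Rounded (j : ℕ) (v : ℕ) (ds ds' : ℕ → ℕ) : Set where
    field
      lowered    : ds' (suc j) ≡ v
      full-below : Full (suc j) ds'
      kept-above : ∀ j' → suc j < j' → ds' j' ≡ ds j'

  round : ∀ j → j < e' → DrainsWithin j → ∀ v b p ds → ds (suc j) ≡ suc v → Full (suc j) ds →
    ∃₂ λ t ds' → t ≤ suc ℓ * W ^ suc j + (2 + ℓ) ×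
      arun x t (abs (scan b) p ds ℓ) ≡ abs (test (suc j) (orDown x p (suc ℓ ^ suc j) b)) (p ∸ suc ℓ ^ suc j) ds' ℓ ×
      Rounded j v ds ds'
  round j j<e' drain-j v b p ds ds1+j≡ full
    with t₁ , ds₁ , t₁≤ , run₁ , drained ← drain-j ℓ b p ds (full j (n<1+n j)) ≤-refl (λ j' j'<j → full j' (m<n⇒m<1+n j'<j))
    with t₃ , ds₃ , t₃≤ , run₃ , refilled ← refill ℓ j (orDown x p (suc ℓ ^ suc j) b) (p ∸ suc ℓ ^ suc j) (adjustAt j suc ds₁) 0 j<e'
                                               (trans (adjustAt-same j suc ds₁) (cong suc (Drained.emptied drained))) refl =
    t₁ + suc t₃ , ds₃ , +-mono-≤ t₁≤ (s≤s t₃≤) , whole-round ,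
    record { lowered    = trans (Refilled.borrowed refilled)
                                (cong pred (trans (adjustAt-other j suc ds₁ (<⇒≢ (n<1+n j) ∘ sym))
                                                  (trans (Drained.kept-above drained (suc j) (n<1+n j)) ds1+j≡)))
           ; full-below = full₃
           ; kept-above = λ j' 1+j<j' → trans (kept₃ j' (>⇒≢ (<-trans (n<1+n j) 1+j<j')) (>⇒≢ 1+j<j'))
                                              (Drained.kept-above drained j' (<-trans (n<1+n j) 1+j<j')) }
    where
    P = suc ℓ ^ suc j
    B = orDown x p P b
    kept₃ : ∀ j' → j' ≢ j → j' ≢ suc j → ds₃ j' ≡ ds₁ j'
    kept₃ j' j'≢j j'≢1+j = trans (Refilled.kept refilled j' j'≢j j'≢1+j) (adjustAt-other j suc ds₁ j'≢j)
    full₃ : Full (suc j) ds₃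
    full₃ j' j'<1+j with j' ≟ j
    ... | yes refl = Refilled.refilled refilled
    ... | no j'≢j  = trans (kept₃ j' j'≢j (<⇒≢ j'<1+j)) (Drained.full-below drained j' (≤∧≢⇒< (m<1+n⇒m≤n j'<1+j) j'≢j))
    test-j : astep x (abs (test j B) (p ∸ P) ds₁ ℓ) ≡ abs (reset j B) (p ∸ P) (adjustAt j suc ds₁) ℓ
    test-j rewrite cong (ruler ℓ) (Drained.emptied drained) | <ᵇ-true j<e' = refl
    whole-round : arun x (t₁ + suc t₃) (abs (scan b) p ds ℓ) ≡ abs (test (suc j) B) (p ∸ P) ds₃ ℓ
    whole-round = begin
      arun x (t₁ + suc t₃) (abs (scan b) p ds ℓ)          ≡⟨ arun-+ x t₁ (suc t₃) _ ⟩
      arun x (suc t₃) (arun x t₁ (abs (scan b) p ds ℓ))   ≡⟨ cong (arun x (suc t₃)) run₁ ⟩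
      arun x t₃ (astep x (abs (test j B) (p ∸ P) ds₁ ℓ))  ≡⟨ cong (arun x t₃) test-j ⟩
      arun x t₃ (abs (reset j B) (p ∸ P) (adjustAt j suc ds₁) ℓ) ≡⟨ run₃ ⟩
      abs (test (suc j) B) (p ∸ P) ds₃ ℓ                  ∎
      where open ≡-Reasoning

  turn-bound : ∀ j → suc ℓ * W ^ suc j + 2 * W ≤ W ^ suc (suc j)
  turn-bound j = begin
    suc ℓ * Y + 2 * W     ≤⟨ +-monoʳ-≤ (suc ℓ * Y) (*-monoʳ-≤ 2 W≤Y) ⟩
    suc ℓ * Y + 2 * Y     ≡⟨ sym (*-distribʳ-+ Y (suc ℓ) 2) ⟩
    (suc ℓ + 2) * Y       ≡⟨ cong (_* Y) (+-comm (suc ℓ) 2) ⟩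
    W * Y                 ∎
    where
    open ≤-Reasoning
    Y = W ^ suc j
    W≤Y : W ≤ Y
    W≤Y = subst (_≤ Y) (*-identityʳ W) (*-monoʳ-≤ W (m^n>0 W j))

  round-bound : ∀ j → suc ℓ * W ^ suc j + (3 + ℓ) ≤ W ^ suc (suc j)
  round-bound j = ≤-trans (+-monoʳ-≤ (suc ℓ * W ^ suc j) (m≤m+n W (1 * W))) (turn-bound j)

  drain-suc : ∀ j → j < e' → DrainsWithin j → DrainsWithin (suc j)
  drain-suc j j<e' drain-j zero b p ds ds≡ _ full
    with t , ds' , t≤ , run≡ , rounded ← round j j<e' drain-j 0 b p ds ds≡ full =
    t , ds' , ≤-trans t≤ (≤-trans (≤-trans (+-monoʳ-≤ _ (n≤1+n (2 + ℓ))) (round-bound j)) (≤-reflexive (sym (+-identityʳ _)))) ,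
    subst (λ m → Drains (suc j) m p b t ds ds') (sym (+-identityʳ (suc ℓ ^ suc j)))
      (run≡ , record { emptied    = Rounded.lowered rounded
                     ; full-below = Rounded.full-below rounded
                     ; kept-above = Rounded.kept-above rounded })
  drain-suc j j<e' drain-j (suc v) b p ds ds≡ v<ℓ full
    with t , ds' , t≤ , run≡ , rounded ← round j j<e' drain-j (suc v) b p ds ds≡ full
    with t₄ , ds₄ , t₄≤ , run₄ , drained ← drain-suc j j<e' drain-j v (orDown x p (suc ℓ ^ suc j) b) (p ∸ suc ℓ ^ suc j) ds'
                                              (Rounded.lowered rounded) (<⇒≤ v<ℓ) (Rounded.full-below rounded) =
    t + suc t₄ , ds₄ , bound , whole-run ,
    record { emptied    = Drained.emptied drained
           ; full-below = Drained.full-below drained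
           ; kept-above = λ j' 1+j<j' → trans (Drained.kept-above drained j' 1+j<j') (Rounded.kept-above rounded j' 1+j<j') }
    where
    P = suc ℓ ^ suc j
    B = orDown x p P b
    resume : astep x (abs (test (suc j) B) (p ∸ P) ds' ℓ) ≡ abs (scan B) (p ∸ P) ds' ℓ
    resume rewrite cong (ruler ℓ) (Rounded.lowered rounded) | ruler-marked v<ℓ = refl
    whole-run : arun x (t + suc t₄) (abs (scan b) p ds ℓ) ≡ abs (test (suc j) (orDown x p (suc (suc v) * P) b)) (p ∸ suc (suc v) * P) ds₄ ℓ
    whole-run = begin
      arun x (t + suc t₄) (abs (scan b) p ds ℓ)               ≡⟨ arun-+ x t (suc t₄) _ ⟩
      arun x (suc t₄) (arun x t (abs (scan b) p ds ℓ))        ≡⟨ cong (arun x (suc t₄)) run≡ ⟩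
      arun x t₄ (astep x (abs (test (suc j) B) (p ∸ P) ds' ℓ)) ≡⟨ cong (arun x t₄) resume ⟩
      arun x t₄ (abs (scan B) (p ∸ P) ds' ℓ)                  ≡⟨ run₄ ⟩
      abs (test (suc j) (orDown x (p ∸ P) (suc v * P) B)) (p ∸ P ∸ suc v * P) ds₄ ℓ
        ≡⟨ cong₂ (λ o h → abs (test (suc j) o) h ds₄ ℓ) (sym (orDown-+ x p P (suc v * P) b)) (∸-+-assoc p P (suc v * P)) ⟩
      abs (test (suc j) (orDown x p (suc (suc v) * P) b)) (p ∸ suc (suc v) * P) ds₄ ℓ ∎
      where open ≡-Reasoning
    bound : t + suc t₄ ≤ suc (suc v) * W ^ suc (suc j)
    bound = begin
      t + suc t₄                                                ≤⟨ +-mono-≤ t≤ (s≤s t₄≤) ⟩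
      suc ℓ * W ^ suc j + (2 + ℓ) + suc (suc v * W ^ suc (suc j)) ≡⟨ trans (+-suc _ _) (cong (_+ suc v * W ^ suc (suc j)) (sym (+-suc (suc ℓ * W ^ suc j) (2 + ℓ)))) ⟩
      suc ℓ * W ^ suc j + (3 + ℓ) + suc v * W ^ suc (suc j)     ≤⟨ +-monoˡ-≤ _ (round-bound j) ⟩
      suc (suc v) * W ^ suc (suc j)                             ∎
      where open ≤-Reasoning

  drain : ∀ j → j ≤ e' → DrainsWithin j
  drain zero    _      = drain-zero
  drain (suc j) 1+j≤e' = drain-suc j 1+j≤e' (drain j (<⇒≤ 1+j≤e'))

n<2^n : ∀ n → n < 2 ^ n
n<2^n zero    = s≤s z≤n
n<2^n (suc n) = begin-strict
  suc n         <⟨ s≤s (n<2^n n) ⟩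
  suc (2 ^ n)   ≤⟨ +-monoˡ-≤ (2 ^ n) (m^n>0 2 n) ⟩
  2 ^ n + 2 ^ n ≡⟨ cong (2 ^ n +_) (sym (+-identityʳ (2 ^ n))) ⟩
  2 ^ suc n     ∎
  where open ≤-Reasoning

symbolAt-nothing : ∀ x p → symbolAt x p ≡ nothing → length x ≤ p
symbolAt-nothing []      p       _  = z≤n
symbolAt-nothing (b ∷ x) (suc p) eq = s≤s (symbolAt-nothing x p eq)

symbolAt-just : ∀ x p {b} → symbolAt x p ≡ just b → p < length x
symbolAt-just (b ∷ x) zero    _  = s≤s z≤n
symbolAt-just (b ∷ x) (suc p) eq = s≤s (symbolAt-just x p eq)

extend-below : ∀ {n J} → (∀ j → j < J → 2 ^ j < n) → 2 ^ J < n → ∀ j → j < suc J → 2 ^ j < n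
extend-below {J = J} below 2^J<n j j<1+J with j ≟ J
... | yes refl = 2^J<n
... | no j≢J   = below j (≤∧≢⇒< (m<1+n⇒m≤n j<1+J) j≢J)

module Probing (e' : ℕ) (x : List Bool) where
  open BlockOrMachine e'

  probe : ∀ fuel J h ds → (∀ j → ds j ≡ suc J) → (∀ j → j < J → 2 ^ j < length x) → length x ≤ fuel + J →
    ∃₂ λ ℓ t → t + 2 * J ≤ 2 * suc ℓ × IsCeilLog₂ ℓ (length x) ×
      ∃ λ ds' → arun x t (abs jump h ds J) ≡ abs (scan false) (2 ^ ℓ) ds' ℓ × (∀ j → ds' j ≡ suc ℓ)
  probe fuel J h ds ds≡ below n≤ with symbolAt x (2 ^ J) in at-2^J
  ... | nothing = J , 2 , ≤-reflexive (sym (*-suc 2 J)) , (symbolAt-nothing x (2 ^ J) at-2^J , below) , ds , two-steps , ds≡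
    where
    two-steps : astep x (astep x (abs jump h ds J)) ≡ abs (scan false) (2 ^ J) ds J
    two-steps rewrite at-2^J = refl
  ... | just _ with fuel
  ...   | zero     = ⊥-elim (<⇒≱ (<-trans (n<2^n J) (symbolAt-just x (2 ^ J) at-2^J)) n≤)
  ...   | suc fuel with ℓ , t , t≤ , ceil , ds' , run≡ , ds'≡
                          ← probe fuel (suc J) (2 ^ J) (suc ∘ ds) (cong suc ∘ ds≡)
                                  (extend-below below (symbolAt-just x (2 ^ J) at-2^J)) (subst (length x ≤_) (sym (+-suc fuel J)) n≤) =
    ℓ , 2 + t , ≤-trans (≤-reflexive steps) t≤ , ceil , ds' , trans (cong (arun x t) two-steps) run≡ , ds'≡
    where
    two-steps : astep x (astep x (abs jump h ds J)) ≡ abs jump (2 ^ J) (suc ∘ ds) (suc J)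
    two-steps rewrite at-2^J = refl
    steps : 2 + t + 2 * J ≡ t + 2 * suc J
    steps = trans (cong (_+ 2 * J) (+-comm 2 t)) (trans (+-assoc t 2 (2 * J)) (cong (t +_) (sym (*-suc 2 J))))

  open Timing e' x using (drain; turn-bound; module Drained)

  private
    total-time : ∀ tₚ t → suc (tₚ + (t + 1)) ≡ t + (2 + tₚ)
    total-time = solve-∀

  blockOr-run : ∃₂ λ ℓ t → IsCeilLog₂ ℓ (length x) × t ≤ (3 + ℓ) ^ suc (suc e') ×
                  HaltsWith M x 0 t (orDown x (2 ^ ℓ) (suc ℓ ^ suc e') false)
  blockOr-run
    with ℓ , tₚ , tₚ≤ , ceil , dsₚ , runₚ , dsₚ≡ ← probe (length x) 0 0 (λ _ → 1) (λ _ → refl) (λ _ ()) (≤-reflexive (sym (+-identityʳ _)))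
    with t , ds , t≤ , run≡ , drained ← drain ℓ e' ≤-refl ℓ false (2 ^ ℓ) dsₚ (dsₚ≡ e') ≤-refl (λ j _ → dsₚ≡ j) =
    ℓ , suc (tₚ + (t + 1)) , ceil , bound ,
    represents-done (simulate-run x (suc (tₚ + (t + 1))) initialAbs (initial M x 0) (represents-initial x)) (cong Abs.phase whole-run)
    where
    B = orDown x (2 ^ ℓ) (suc ℓ ^ suc e') false
    bound : suc (tₚ + (t + 1)) ≤ (3 + ℓ) ^ suc (suc e')
    bound = begin
      suc (tₚ + (t + 1))                  ≡⟨ total-time tₚ t ⟩
      t + (2 + tₚ)                         ≤⟨ +-mono-≤ t≤ (+-monoʳ-≤ 2 (subst (_≤ 2 * suc ℓ) (+-identityʳ tₚ) tₚ≤)) ⟩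
      suc ℓ * (3 + ℓ) ^ suc e' + (2 + 2 * suc ℓ) ≤⟨ +-monoʳ-≤ _ (≤-trans (≤-reflexive (sym (*-suc 2 (suc ℓ)))) (*-monoʳ-≤ 2 (n≤1+n (2 + ℓ)))) ⟩
      suc ℓ * (3 + ℓ) ^ suc e' + 2 * (3 + ℓ) ≤⟨ turn-bound ℓ e' ⟩
      (3 + ℓ) ^ suc (suc e')               ∎
      where open ≤-Reasoning
    finish : astep x (abs (test e' B) (2 ^ ℓ ∸ suc ℓ ^ suc e') ds ℓ) ≡ abs (done B) (2 ^ ℓ ∸ suc ℓ ^ suc e') ds ℓ
    finish rewrite cong (ruler ℓ) (Drained.emptied drained) | <ᵇ-false (≤-refl {e'}) = refl
    whole-run : arun x (suc (tₚ + (t + 1))) initialAbs ≡ abs (done B) (2 ^ ℓ ∸ suc ℓ ^ suc e') ds ℓ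
    whole-run = begin
      arun x (tₚ + (t + 1)) (abs jump 0 (λ _ → 1) 0)                 ≡⟨ arun-+ x tₚ (t + 1) _ ⟩
      arun x (t + 1) (arun x tₚ (abs jump 0 (λ _ → 1) 0))            ≡⟨ cong (arun x (t + 1)) runₚ ⟩
      arun x (t + 1) (abs (scan false) (2 ^ ℓ) dsₚ ℓ)                 ≡⟨ arun-+ x t 1 _ ⟩
      arun x 1 (arun x t (abs (scan false) (2 ^ ℓ) dsₚ ℓ))           ≡⟨ cong (arun x 1) run≡ ⟩
      astep x (abs (test e' B) (2 ^ ℓ ∸ suc ℓ ^ suc e') ds ℓ)        ≡⟨ finish ⟩
      abs (done B) (2 ^ ℓ ∸ suc ℓ ^ suc e') ds ℓ                     ∎
      where open ≡-Reasoning

*-^-distrib : ∀ a b n → (a * b) ^ n ≡ a ^ n * b ^ n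
*-^-distrib a b zero    = refl
*-^-distrib a b (suc n) = trans (cong (a * b *_) (*-^-distrib a b n)) (interchange a b (a ^ n) (b ^ n))
  where
  interchange : ∀ a b c d → a * b * (c * d) ≡ a * c * (b * d)
  interchange = solve-∀

isCeilLog₂-unique : ∀ {ℓ ℓ' n} → IsCeilLog₂ ℓ n → IsCeilLog₂ ℓ' n → ℓ ≡ ℓ'
isCeilLog₂-unique {ℓ} {ℓ'} (n≤2^ℓ , below) (n≤2^ℓ' , below') with <-cmp ℓ ℓ'
... | tri< ℓ<ℓ' _ _ = ⊥-elim (<⇒≱ (below' ℓ ℓ<ℓ') n≤2^ℓ)
... | tri≈ _ ℓ≡ℓ' _ = ℓ≡ℓ'
... | tri> _ _ ℓ>ℓ' = ⊥-elim (<⇒≱ (below ℓ' ℓ>ℓ') n≤2^ℓ')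

isCeilLog₂-≤ : ∀ {ℓ n} → IsCeilLog₂ ℓ n → ℓ ≤ suc ⌈log₂ n ⌉
isCeilLog₂-≤ {zero}  _          = z≤n
isCeilLog₂-≤ {suc ℓ} {n} (_ , below) =
  s≤s (subst (_≤ ⌈log₂ n ⌉) (⌈log₂2^n⌉≡n ℓ) (⌈log₂⌉-mono-≤ (<⇒≤ (below ℓ ≤-refl))))

blockOr∈PPL : ∀ e' → PPL (BlockOr e')
blockOr∈PPL e' = suc e' , M , 4 ^ k , decides
  where
  open BlockOrMachine e'
  k = suc (suc e')
  decides : DecidesIn M (BlockOr e') (λ n → 4 ^ k * (1 + ⌈log₂ n ⌉) ^ k)
  decides x with ℓ , t , ceil , t≤ , halts ← Probing.blockOr-run e' x =
    t , time , _ , halts , mk⇔ to from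
    where
    lg = ⌈log₂ length x ⌉
    time : t ≤ 4 ^ k * (1 + lg) ^ k
    time = begin
      t                       ≤⟨ t≤ ⟩
      (3 + ℓ) ^ k             ≤⟨ ^-monoˡ-≤ k (+-monoʳ-≤ 3 (isCeilLog₂-≤ ceil)) ⟩
      (4 + lg) ^ k             ≤⟨ ^-monoˡ-≤ k (≤-trans (+-monoʳ-≤ 4 (m≤n*m lg 4)) (≤-reflexive (sym (*-distribˡ-+ 4 1 lg)))) ⟩
      (4 * (1 + lg)) ^ k       ≡⟨ *-^-distrib 4 (1 + lg) k ⟩
      4 ^ k * (1 + lg) ^ k     ∎
      where open ≤-Reasoning
    to : BlockOr e' x → orDown x (2 ^ ℓ) (suc ℓ ^ suc e') false ≡ true
    to (ℓ' , ceil' , set) rewrite isCeilLog₂-unique ceil ceil' = set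
    from : orDown x (2 ^ ℓ) (suc ℓ ^ suc e') false ≡ true → BlockOr e' x
    from set = ℓ , ceil , set

square≤2^ : ∀ k → (4 + k) * (4 + k) ≤ 2 ^ (4 + k)
square≤2^ zero    = ≤-refl
square≤2^ (suc k) = begin
  suc m * suc m    ≡⟨ expand m ⟩
  m * m + (2 * m + 1) ≤⟨ +-monoʳ-≤ (m * m) linear ⟩
  m * m + m * m    ≤⟨ +-mono-≤ (square≤2^ k) (square≤2^ k) ⟩
  2 ^ m + 2 ^ m    ≡⟨ cong (2 ^ m +_) (sym (+-identityʳ (2 ^ m))) ⟩
  2 ^ suc m        ∎
  where
  open ≤-Reasoning
  m = 4 + k
  expand : ∀ m → suc m * suc m ≡ m * m + (2 * m + 1)
  expand = solve-∀
  linear : 2 * m + 1 ≤ m * m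
  linear = begin
    2 * m + 1 ≤⟨ +-monoʳ-≤ (2 * m) (s≤s (z≤n {1})) ⟩
    2 * m + 2 ≡⟨ cong (_+ 2) (*-comm 2 m) ⟩
    m * 2 + 2 ≤⟨ +-monoʳ-≤ (m * 2) (m≤m+n 2 (2 + k)) ⟩
    m * 2 + m ≡⟨ trans (+-comm (m * 2) m) (sym (*-suc m 2)) ⟩
    m * 3     ≤⟨ *-monoʳ-≤ m (m≤m+n 3 (1 + k)) ⟩
    m * m     ∎

∃-large : ∀ d C → ∃ λ N → C ≤ suc N × suc N ^ d ≤ 2 ^ N
∃-large d C = pred (2 ^ s) , C≤ , power≤
  where
  s = 4 + (d + C)
  1+N≡2^s : suc (pred (2 ^ s)) ≡ 2 ^ s
  1+N≡2^s = suc-pred (2 ^ s) {{m^n≢0 2 s}}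
  C≤ : C ≤ suc (pred (2 ^ s))
  C≤ = subst (C ≤_) (sym 1+N≡2^s) (<⇒≤ (<-≤-trans (n<2^n C) (^-monoʳ-≤ 2 (m≤n+m C (4 + d)))))
  s*d<2^s : s * d < 2 ^ s
  s*d<2^s = <-≤-trans (*-monoʳ-< s (s≤s (≤-trans (m≤m+n d C) (m≤n+m (d + C) 3)))) (square≤2^ (d + C))
  power≤ : suc (pred (2 ^ s)) ^ d ≤ 2 ^ pred (2 ^ s)
  power≤ rewrite 1+N≡2^s = subst (_≤ 2 ^ pred (2 ^ s)) (sym (^-*-assoc 2 s d)) (^-monoʳ-≤ 2 (suc[m]≤n⇒m≤pred[n] s*d<2^s))

log₂-poly≤ : ∀ c N → ⌈log₂ (c * (2 ^ N) ^ c + c) ⌉ ≤ suc (c + N * c)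
log₂-poly≤ c N = subst (⌈log₂ (c * (2 ^ N) ^ c + c) ⌉ ≤_) (⌈log₂2^n⌉≡n (suc (c + N * c))) (⌈log₂⌉-mono-≤ poly≤)
  where
  E = 2 ^ (c + N * c)
  poly≤ : c * (2 ^ N) ^ c + c ≤ 2 ^ suc (c + N * c)
  poly≤ = begin
    c * (2 ^ N) ^ c + c        ≡⟨ cong (λ y → c * y + c) (^-*-assoc 2 N c) ⟩
    c * 2 ^ (N * c) + c        ≤⟨ +-mono-≤ (*-monoˡ-≤ (2 ^ (N * c)) (<⇒≤ (n<2^n c))) (<⇒≤ (<-≤-trans (n<2^n c) (^-monoʳ-≤ 2 (m≤m+n c (N * c))))) ⟩
    2 ^ c * 2 ^ (N * c) + E    ≡⟨ cong (_+ E) (sym (^-distribˡ-+-* 2 c (N * c))) ⟩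
    E + E                      ≡⟨ cong (E +_) (sym (+-identityʳ E)) ⟩
    2 ^ suc (c + N * c)        ∎
    where open ≤-Reasoning

query-bound : ∀ i cP cf c N lg T D → lg ≤ suc (c + N * c) →
  T ≤ cP * (1 + lg) ^ suc i → D ≤ cf * (1 + N + lg) →
  T * D ≤ cP * cf * (2 * suc c) ^ suc (suc i) * suc N ^ suc (suc i)
query-bound i cP cf c N lg T D lg≤ T≤ D≤ = begin
  T * D                                   ≤⟨ *-mono-≤ (≤-trans T≤ (*-monoʳ-≤ cP (^-monoˡ-≤ (suc i) 1+lg≤X))) (≤-trans D≤ (*-monoʳ-≤ cf 1+N+lg≤X)) ⟩
  cP * X ^ suc i * (cf * X)               ≡⟨ regroup cP cf X (X ^ suc i) ⟩
  cP * cf * (X * X ^ suc i)               ≡⟨ cong (cP * cf *_) (*-^-distrib (2 * suc c) (suc N) (suc (suc i))) ⟩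
  cP * cf * ((2 * suc c) ^ suc (suc i) * suc N ^ suc (suc i)) ≡⟨ sym (*-assoc (cP * cf) _ _) ⟩
  cP * cf * (2 * suc c) ^ suc (suc i) * suc N ^ suc (suc i)   ∎
  where
  open ≤-Reasoning
  X = 2 * suc c * suc N
  regroup : ∀ a b x y → a * y * (b * x) ≡ a * b * (x * y)
  regroup = solve-∀
  split₁ : ∀ c N → 2 * suc c * suc N ≡ (2 + c + N * c) + (c + N * c + 2 * N)
  split₁ = solve-∀
  split₂ : ∀ c N → 2 * suc c * suc N ≡ (1 + N + suc (c + N * c)) + (N + c + N * c)
  split₂ = solve-∀
  1+lg≤X : 1 + lg ≤ X
  1+lg≤X = ≤-trans (s≤s lg≤) (subst (2 + c + N * c ≤_) (sym (split₁ c N)) (m≤m+n _ _))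
  1+N+lg≤X : 1 + N + lg ≤ X
  1+N+lg≤X = ≤-trans (+-monoʳ-≤ (1 + N) lg≤) (subst (1 + N + suc (c + N * c) ≤_) (sym (split₂ c N)) (m≤m+n _ _))

<pred-scaled : ∀ {k c V N} → 1 ≤ V → k ≤ c * V → c + 2 ≤ suc N → k < pred (suc N * V)
<pred-scaled {k} {c} {V} {N} 1≤V k≤cV c+2≤1+N = suc[m]≤n⇒m≤pred[n] (begin
  suc (suc k)     ≤⟨ +-monoʳ-≤ 2 k≤cV ⟩
  2 + c * V       ≤⟨ +-monoˡ-≤ (c * V) (*-monoʳ-≤ 2 1≤V) ⟩
  2 * V + c * V   ≡⟨ sym (*-distribʳ-+ V 2 c) ⟩
  (2 + c) * V     ≤⟨ *-monoˡ-≤ V (≤-trans (≤-reflexive (+-comm 2 c)) c+2≤1+N) ⟩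
  suc N * V       ∎)
  where open ≤-Reasoning

-- BlockOr depends on many input bits, a reduction to PPL on few

setAt : List Bool → ℕ → List Bool
setAt []      q       = []
setAt (b ∷ x) zero    = true ∷ x
setAt (b ∷ x) (suc q) = b ∷ setAt x q

length-setAt : ∀ x q → length (setAt x q) ≡ length x
length-setAt []      q       = refl
length-setAt (b ∷ x) zero    = refl
length-setAt (b ∷ x) (suc q) = cong suc (length-setAt x q)

symbolAt-setAt-same : ∀ x q → q < length x → symbolAt (setAt x q) q ≡ just true
symbolAt-setAt-same (b ∷ x) zero    _         = refl
symbolAt-setAt-same (b ∷ x) (suc q) (s≤s q<n) = symbolAt-setAt-same x q q<n

symbolAt-setAt-other : ∀ x {q p} → p ≢ q → symbolAt (setAt x q) p ≡ symbolAt x p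
symbolAt-setAt-other []      p≢q = refl
symbolAt-setAt-other (b ∷ x) {zero}  {zero}  p≢q = ⊥-elim (p≢q refl)
symbolAt-setAt-other (b ∷ x) {zero}  {suc p} p≢q = refl
symbolAt-setAt-other (b ∷ x) {suc q} {zero}  p≢q = refl
symbolAt-setAt-other (b ∷ x) {suc q} {suc p} p≢q = symbolAt-setAt-other x (p≢q ∘ cong suc)

orDown-true : ∀ x p m → orDown x p m true ≡ true
orDown-true x p zero    = refl
orDown-true x p (suc m) = orDown-true x (pred p) m

isSet-zeros : ∀ n p → isSet (symbolAt (replicate n false) p) ≡ false
isSet-zeros zero    p       = refl
isSet-zeros (suc n) zero    = refl
isSet-zeros (suc n) (suc p) = isSet-zeros n p

orDown-zeros : ∀ n p m → orDown (replicate n false) p m false ≡ false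
orDown-zeros n p zero    = refl
orDown-zeros n p (suc m) rewrite isSet-zeros n p = orDown-zeros n (pred p) m

orDown-hit : ∀ x p m b s → s < m → s ≤ p → isSet (symbolAt x (p ∸ s)) ≡ true → orDown x p m b ≡ true
orDown-hit x p       (suc m) b zero    _         _         set rewrite set | ∨-zeroʳ b = orDown-true x (pred p) m
orDown-hit x (suc p) (suc m) b (suc s) (s≤s s<m) (s≤s s≤p) set = orDown-hit x p m _ s s<m s≤p set

¬blockOr-zeros : ∀ e n → ¬ BlockOr e (replicate n false)
¬blockOr-zeros e n (ℓ , _ , set) with () ← trans (sym (orDown-zeros n (2 ^ ℓ) (suc ℓ ^ suc e))) set

isCeilLog₂-2^ : ∀ N → IsCeilLog₂ N (2 ^ N)
isCeilLog₂-2^ N = ≤-refl , λ j j<N → ^-monoʳ-< 2 (s≤s (s≤s z≤n)) j<N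

module _ (e N : ℕ) where
  private
    n = 2 ^ N
    m = suc N ^ suc e
    zeros = replicate n false
    -- the cell n ∸ suc r is the one at offset r in the window scanned below position n
    offset : ℕ → ℕ
    offset p = pred (n ∸ p)

  blockOr-sensitive : (ps : List ℕ) → suc N ^ suc e ≤ 2 ^ N → length ps < pred (suc N ^ suc e) →
    ∃ λ x → length x ≡ 2 ^ N × (∀ p → p ∈ ps → symbolAt (replicate (2 ^ N) false) p ≡ symbolAt x p) × BlockOr e x
  blockOr-sensitive ps m≤n few with r , r<m-1 , r∉ ← ∃∉-below (pred m) (map offset ps) (subst (_< pred m) (sym (length-map offset ps)) few) =
    x , length-x , agree , N , subst (IsCeilLog₂ N) (sym length-x) (isCeilLog₂-2^ N) ,
    orDown-hit x n m false (suc r) 1+r<m 1+r≤n (cong isSet (symbolAt-setAt-same zeros q (subst (q <_) (sym (length-replicate n)) q<n)))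
    where
    1+r<m : suc r < m
    1+r<m = m<pred[n]⇒suc[m]<n r<m-1
      where
      m<pred[n]⇒suc[m]<n : ∀ {a b} → a < pred b → suc a < b
      m<pred[n]⇒suc[m]<n {b = suc b} a<b = s≤s a<b
    1+r≤n : suc r ≤ n
    1+r≤n = ≤-trans (<⇒≤ 1+r<m) m≤n
    q = n ∸ suc r
    q<n : q < n
    q<n = ∸-monoʳ-< (s≤s z≤n) 1+r≤n
    x = setAt zeros q
    length-x : length x ≡ n
    length-x = trans (length-setAt zeros q) (length-replicate n)
    agree : ∀ p → p ∈ ps → symbolAt zeros p ≡ symbolAt x p
    agree p p∈ps with p ≟ q
    ... | yes refl = ⊥-elim (r∉ (subst (_∈ map offset ps) (cong pred (m∸[m∸n]≡n 1+r≤n)) (∈-map⁺ offset p∈ps)))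
    ... | no p≢q   = sym (symbolAt-setAt-other zeros p≢q)

symbolAt-beyond : ∀ y p → length y ≤ p → symbolAt y p ≡ nothing
symbolAt-beyond []      p       _         = refl
symbolAt-beyond (b ∷ y) (suc p) (s≤s |y|≤p) = symbolAt-beyond y p |y|≤p

reduction-local : ∀ {P Q} i → PPLⁱ (suc i) P → DLOGTIMEReduces Q P →
  ∃ λ c → ∀ N x → length x ≡ 2 ^ N → ∃ λ (ps : List ℕ) → length ps ≤ c * suc N ^ suc (suc i) ×
    (∀ x' → length x' ≡ 2 ^ N → (∀ p → p ∈ ps → symbolAt x p ≡ symbolAt x' p) → Q x' → Q x)
reduction-local {P} {Q} i (MP , cP , decide) (f , (cp , poly) , Q⇔P∘f , Mf , cf , bits) =
  cP * cf * (2 * suc cp) ^ suc (suc i) , local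
  where
  local : ∀ N x → length x ≡ 2 ^ N → ∃ λ (ps : List ℕ) → length ps ≤ cP * cf * (2 * suc cp) ^ suc (suc i) * suc N ^ suc (suc i) ×
    (∀ x' → length x' ≡ 2 ^ N → (∀ p → p ∈ ps → symbolAt x p ≡ symbolAt x' p) → Q x' → Q x)
  local N x |x|≡ with T , T≤ , b , halts , P⇔b ← decide (f x) = ps , ps-bound , sound
    where
    B = cp * (2 ^ N) ^ cp + cp
    lg = ⌈log₂ B ⌉
    |f|≤B : ∀ x' → length x' ≡ 2 ^ N → length (f x') ≤ B
    |f|≤B x' |x'|≡ = subst (λ n → length (f x') ≤ cp * n ^ cp + cp) |x'|≡ (poly x')
    bit-time : ℕ → ℕ
    bit-time p = proj₁ (bits x p)
    queriesOf : ∀ p → Dec (p < B) → List ℕ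
    queriesOf p (yes _) = visited Mf x (suc p) (bit-time p)
    queriesOf p (no _)  = []
    read : ℕ → ℕ
    read = headAt MP (f x) 0
    ps : List ℕ
    ps = unionBelow (λ s → queriesOf (read s) (read s <? B)) T
    D = cf * (1 + N + lg)
    queries≤ : ∀ s → s < T → length (queriesOf (read s) (read s <? B)) ≤ D
    queries≤ s _ with read s <? B
    ... | no _  = z≤n
    ... | yes p<B = begin
      length (visited Mf x (suc (read s)) (bit-time (read s)))  ≡⟨ length-visited Mf x _ _ ⟩
      bit-time (read s)                                          ≤⟨ proj₁ (proj₂ (bits x (read s))) ⟩
      cf * (1 + ⌈log₂ length x ⌉ + ⌈log₂ suc (read s) ⌉)         ≤⟨ *-monoʳ-≤ cf (+-mono-≤ (≤-reflexive (cong suc (trans (cong ⌈log₂_⌉ |x|≡) (⌈log₂2^n⌉≡n N)))) (⌈log₂⌉-mono-≤ p<B)) ⟩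
      D                                                          ∎
      where open ≤-Reasoning
    T≤′ : T ≤ cP * (1 + lg) ^ suc i
    T≤′ = ≤-trans T≤ (*-monoʳ-≤ cP (^-monoˡ-≤ (suc i) (s≤s (⌈log₂⌉-mono-≤ (|f|≤B x |x|≡)))))
    ps-bound : length ps ≤ cP * cf * (2 * suc cp) ^ suc (suc i) * suc N ^ suc (suc i)
    ps-bound = ≤-trans (length-unionBelow _ T D queries≤) (query-bound i cP cf cp N lg T D (log₂-poly≤ cp N) T≤′ ≤-refl)
    sound : ∀ x' → length x' ≡ 2 ^ N → (∀ p → p ∈ ps → symbolAt x p ≡ symbolAt x' p) → Q x' → Q x
    sound x' |x'|≡ agree Qx' with T' , _ , b' , halts' , P⇔b' ← decide (f x') =
      Equivalence.from (Q⇔P∘f x) (Equivalence.from P⇔b (trans (sym b'≡b) (Equivalence.to P⇔b' (Equivalence.to (Q⇔P∘f x') Qx'))))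
      where
      same-read : ∀ s → s < T → symbolAt (f x) (read s) ≡ symbolAt (f x') (read s)
      same-read s s<T with read s <? B in dec≡
      ... | no p≮B  = trans (symbolAt-beyond (f x) (read s) (≤-trans (|f|≤B x |x|≡) (≮⇒≥ p≮B)))
                            (sym (symbolAt-beyond (f x') (read s) (≤-trans (|f|≤B x' |x'|≡) (≮⇒≥ p≮B))))
      ... | yes p<B = HaltsWith-output-cong Mf x x' (suc (read s)) (bit-time (read s)) (proj₁ (bits x' (read s)))
            (λ q q∈ → agree q (∈-unionBelow s<T (subst (q ∈_) (cong (queriesOf (read s)) (sym dec≡)) q∈)))
            (proj₂ (proj₂ (bits x (read s)))) (proj₂ (proj₂ (bits x' (read s))))
      b'≡b : b' ≡ b
      b'≡b = HaltsWith-functional MP (f x') 0 T' T halts' (HaltsWith-cong-input MP (f x) (f x') 0 T same-read halts)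

theorem13 : ¬ (Σ Problem λ P → PPL P × (∀ Q → PPL Q → DLOGTIMEReduces Q P))
theorem13 (P , (i , decider) , complete) =
  let c , local              = reduction-local i decider (complete (BlockOr (2 + i)) (blockOr∈PPL (2 + i)))
      N , c+2≤1+N , large    = ∃-large (3 + i) (c + 2)
      ps , |ps|≤ , only-ps   = local N (replicate (2 ^ N) false) (length-replicate (2 ^ N))
      x , |x|≡ , agree , x∈  = blockOr-sensitive (2 + i) N ps large (<pred-scaled (m^n>0 (suc N) (2 + i)) |ps|≤ c+2≤1+N)
  in ¬blockOr-zeros (2 + i) (2 ^ N) (only-ps x |x|≡ agree x∈)
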